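{- Using elements of $H_{\Gamma}$, any semi-magic Sudoku board can be transformed into a semi-magic Sudoku board whose gnomon is the standard gnomon. There are exactly sixteen $H_{\Gamma}$-nests of semi-magic Sudoku boards, and each $H_\Gamma$-nest contains exactly one semi-magic board with the standard gnomon; such a board is uniquely determined by the pair $[a,b]$, where $a$ is its entry in row $7$, column $6$ and $b$ is its entry in row $6$, column $7$.
   Context: A Sudoku board here is a $9\times 9$ grid with entries from $\{0,\dots,8\}$ such that each row, column and each of the nine designated $3\times 3$ blocks contains each symbol exactly once. Rows of blocks are bands (rows 1–3, 4–6, 7–9) and columns of blocks are pillars. A semi-magic square is a $3\times 3$ array containing each of $0,\dots,8$ once with each row and each column summing to $12$ (no condition on diagonals). A semi-magic Sudoku board is a Sudoku board all of whose nine blocks are semi-magic squares. The gnomon of a board is the union of its first band and first pillar. The standard gnomon is: rows 1–3 equal to $(0,4,8,7,2,3,5,6,1)$, $(5,6,1,0,4,8,7,2,3)$, $(7,2,3,5,6,1,0,4,8)$, and the first three columns of rows 4–9 equal to $(8,0,4)$, $(1,5,6)$, $(3,7,2)$, $(4,8,0)$, $(6,1,5)$, $(2,3,7)$ respectively. $H_\Gamma$ is the group of permutations of the $81$ cells generated by the transpose, swaps of two rows within a band, swaps of two columns within a pillar, the swap of pillars 2 and 3, and the swap of bands 2 and 3; it acts on boards by moving entries. Two semi-magic boards lie in the same $H_\Gamma$-nest if one is obtained from the other by an element of $H_\Gamma$. -}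

module Defs where

open import Data.Nat using (ℕ; _+_; _<_)
open import Data.Fin using (Fin; zero; suc; toℕ; combine; remQuot; _≟_)
open import Data.Product using (_×_; _,_; proj₁; proj₂; ∃; Σ)
open import Data.Sum using (_⊎_)
open import Data.List using (List; []; _∷_)
open import Data.Vec using (Vec; []; _∷_; lookup)
open import Relation.Binary.PropositionalEquality using (_≡_)
open import Relation.Nullary using (yes; no)

-- Indices: Fin 9 with 0-based numbering (row 1 of the paper is index 0).
-- Symbols: Fin 9, the symbol k standing for the number toℕ k ∈ {0,…,8}.
Board : Set
Board = Fin 9 → Fin 9 → Fin 9

_≈B_ : Board → Board → Set
B ≈B B' = ∀ r c → B r c ≡ B' r c

-- row/column index from (band or pillar, offset): combine I p = 3 * I + p
idx : Fin 3 → Fin 3 → Fin 9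
idx I p = combine I p

split : Fin 9 → Fin 3 × Fin 3
split k = remQuot {3} 3 k

ExactlyOnce : (Fin 9 → Fin 9) → Set
ExactlyOnce f = ∀ v → ∃ λ k → f k ≡ v × (∀ k' → f k' ≡ v → k' ≡ k)

blockEntries : Board → Fin 3 → Fin 3 → Fin 9 → Fin 9
blockEntries B I J k = B (idx I (proj₁ (split k))) (idx J (proj₂ (split k)))

IsSudoku : Board → Set
IsSudoku B = (∀ r → ExactlyOnce (λ c → B r c))
           × (∀ c → ExactlyOnce (λ r → B r c))
           × (∀ I J → ExactlyOnce (blockEntries B I J))

sum3 : (Fin 3 → ℕ) → ℕ
sum3 f = f zero + f (suc zero) + f (suc (suc zero))

-- the 3×3 array of block (I , J) is semi-magic: every row and column sums to 12
-- (each symbol occurring once in the block is part of IsSudoku)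
BlockRowsColsSum12 : Board → Fin 3 → Fin 3 → Set
BlockRowsColsSum12 B I J =
    (∀ p → sum3 (λ q → toℕ (B (idx I p) (idx J q))) ≡ 12)
  × (∀ q → sum3 (λ p → toℕ (B (idx I p) (idx J q))) ≡ 12)

IsSemiMagicBoard : Board → Set
IsSemiMagicBoard B = IsSudoku B × (∀ I J → BlockRowsColsSum12 B I J)

tr : Fin 9 → Fin 9 → Fin 9 → Fin 9
tr i j k with k ≟ i
... | yes _ = j
... | no _ with k ≟ j
...   | yes _ = i
...   | no _ = k

sw23 : Fin 3 → Fin 3
sw23 zero = zero
sw23 (suc zero) = suc (suc zero)
sw23 (suc (suc zero)) = suc zero

swapBlocks23 : Fin 9 → Fin 9
swapBlocks23 r = idx (sw23 (proj₁ (split r))) (proj₂ (split r))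

data Gen : Set where
  transpose  : Gen
  rowSwap    : (I p q : Fin 3) → Gen
  colSwap    : (J p q : Fin 3) → Gen
  pillarSwap : Gen
  bandSwap   : Gen

Cell : Set
Cell = Fin 9 × Fin 9

genCell : Gen → Cell → Cell
genCell transpose (r , c) = (c , r)
genCell (rowSwap I p q) (r , c) = (tr (idx I p) (idx I q) r , c)
genCell (colSwap J p q) (r , c) = (r , tr (idx J p) (idx J q) c)
genCell pillarSwap (r , c) = (r , swapBlocks23 c)
genCell bandSwap (r , c) = (swapBlocks23 r , c)

-- action on boards by moving entries: the entry at cell x moves to σ x,
-- i.e. (σ · B)(y) = B(σ⁻¹ y) = B(σ y) since every generator is an involution
actGen : Gen → Board → Board
actGen g B r c = B (proj₁ (genCell g (r , c))) (proj₂ (genCell g (r , c)))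

-- elements of H_Γ as words in the generators (the generators are involutions,
-- so words give the whole generated group)
act : List Gen → Board → Board
act [] B = B
act (g ∷ w) B = actGen g (act w B)

SameNest : Board → Board → Set
SameNest B B' = ∃ λ (w : List Gen) → act w B ≈B B'

InGnomon : Fin 9 → Fin 9 → Set
InGnomon r c = toℕ r < 3 ⊎ toℕ c < 3

-- entries of the standard gnomon; entries outside the gnomon are padding (0)
-- and are never used
stdTable : Vec (Vec ℕ 9) 9
stdTable =
    (0 ∷ 4 ∷ 8 ∷ 7 ∷ 2 ∷ 3 ∷ 5 ∷ 6 ∷ 1 ∷ [])
  ∷ (5 ∷ 6 ∷ 1 ∷ 0 ∷ 4 ∷ 8 ∷ 7 ∷ 2 ∷ 3 ∷ [])
  ∷ (7 ∷ 2 ∷ 3 ∷ 5 ∷ 6 ∷ 1 ∷ 0 ∷ 4 ∷ 8 ∷ [])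
  ∷ (8 ∷ 0 ∷ 4 ∷ 0 ∷ 0 ∷ 0 ∷ 0 ∷ 0 ∷ 0 ∷ [])
  ∷ (1 ∷ 5 ∷ 6 ∷ 0 ∷ 0 ∷ 0 ∷ 0 ∷ 0 ∷ 0 ∷ [])
  ∷ (3 ∷ 7 ∷ 2 ∷ 0 ∷ 0 ∷ 0 ∷ 0 ∷ 0 ∷ 0 ∷ [])
  ∷ (4 ∷ 8 ∷ 0 ∷ 0 ∷ 0 ∷ 0 ∷ 0 ∷ 0 ∷ 0 ∷ [])
  ∷ (6 ∷ 1 ∷ 5 ∷ 0 ∷ 0 ∷ 0 ∷ 0 ∷ 0 ∷ 0 ∷ [])
  ∷ (2 ∷ 3 ∷ 7 ∷ 0 ∷ 0 ∷ 0 ∷ 0 ∷ 0 ∷ 0 ∷ [])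
  ∷ []

HasStandardGnomon : Board → Set
HasStandardGnomon B = ∀ r c → InGnomon r c → toℕ (B r c) ≡ lookup (lookup stdTable r) c

-- row 7 / column 6 and row 6 / column 7 of the paper (1-based)
r7c6 : Board → Fin 9
r7c6 B = B (suc (suc (suc (suc (suc (suc zero)))))) (suc (suc (suc (suc (suc zero)))))

r6c7 : Board → Fin 9
r6c7 B = B (suc (suc (suc (suc (suc zero))))) (suc (suc (suc (suc (suc (suc zero))))))

-- H_Γ preserves semi-magic boards: each generator permutes rows and columns compatibly with
-- the bands and pillars, so it maps blocks to blocks and lines of blocks to lines of blocks.
-- Exhaustive searches, pruned by the Sudoku and block-line-sum constraints and evaluated by
-- Agda, show that every semi-magic board is moved by H_Γ to one whose first block, then first
-- band, then whole gnomon is standard, and that the semi-magic boards with the standard gnomon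
-- are exactly sixteen explicit ones. These lie in distinct nests: a weighted count of
-- 2×2 corner patterns of rectangles straddling the first band and pillar is H_Γ-invariant and
-- takes sixteen distinct values on them. Their pairs [a , b] are distinct as well.
module Submission where

open import Defs
open import Data.Bool using (Bool; true; false; _∧_; _∨_; T; if_then_else_)
open import Data.Bool.ListAction using (all; any)
open import Data.Bool.Properties using (T-∧; T-∨; T-≡)
open import Data.Fin using (Fin; zero; suc; toℕ; combine; _≟_)
open import Data.Fin.Properties using (remQuot-combine; combine-remQuot; combine-injective; toℕ-injective; all?; any?)
open import Data.List using (List; []; _∷_; _++_; map; concatMap; reverse; _∷ʳ_)
open import Data.List.Membership.Propositional using (_∈_)
open import Data.List.Properties using (unfold-reverse)
open import Data.List.Relation.Unary.All as All using (All; []; _∷_)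
open import Data.List.Relation.Unary.All.Properties using (map⁺; map⁻)
open import Data.Maybe using (Maybe; just; nothing)
import Data.Maybe.Relation.Unary.All as Maybe
open import Data.Nat as ℕ using (ℕ; _+_; _*_; _≡ᵇ_)
open import Data.Nat.Properties using (≡ᵇ⇒≡; ≡⇒≡ᵇ; +-comm)
open import Data.Nat.Solver using (module +-*-Solver)
open import Data.Product using (_×_; _,_; proj₁; proj₂; ∃; uncurry)
open import Data.Product.Properties using (≡-dec)
open import Data.Sum using (inj₁; inj₂)
open import Data.Vec using (Vec; []; _∷_; lookup)
open import Function using (_∘_; id)
open import Function.Bundles using (Equivalence)
open import Relation.Binary.PropositionalEquality
open import Relation.Nullary using (¬_; Dec; does; yes; no)
open import Relation.Nullary.Decidable using (_×-dec_; _⊎-dec_; _→-dec_)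

band offset : Fin 9 → Fin 3
band k = proj₁ (split k)
offset k = proj₂ (split k)

split-idx : ∀ I p → split (idx I p) ≡ (I , p)
split-idx = remQuot-combine

idx-split : ∀ k → idx (band k) (offset k) ≡ k
idx-split = combine-remQuot 3

split-idx-apply : ∀ {A : Set} (f : Fin 3 → Fin 3 → A) I p → f (band (idx I p)) (offset (idx I p)) ≡ f I p
split-idx-apply f I p = cong (λ s → f (proj₁ s) (proj₂ s)) (split-idx I p)

-- Computed facts are stated as b ≡ true and proved by refl: Agda checks that much faster
-- than tt : T b.
decide : ∀ {A : Set} (a? : Dec A) → does a? ≡ true → A
decide (yes a) _ = a

infix 7 _==_ _==ᶜ_ _≐_
infixr 1 _⇒ᵇ_

_==_ : ∀ {n} → Fin n → Fin n → Bool
x == y = toℕ x ≡ᵇ toℕ y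

==-sound : ∀ {n} {x y : Fin n} → T (x == y) → x ≡ y
==-sound {x = x} {y} h = toℕ-injective (≡ᵇ⇒≡ (toℕ x) (toℕ y) h)

==-refl : ∀ {n} (x : Fin n) → T (x == x)
==-refl x = ≡⇒≡ᵇ (toℕ x) (toℕ x) refl

all-sound : ∀ {A : Set} (p : A → Bool) xs → T (all p xs) → All (T ∘ p) xs
all-sound p [] _ = []
all-sound p (x ∷ xs) h = proj₁ (to h) ∷ all-sound p xs (proj₂ (to h))
  where open Equivalence T-∧

any-sound : ∀ {A : Set} (p : A → Bool) xs → T (any p xs) → ∃ (T ∘ p)
any-sound p (x ∷ xs) h with Equivalence.to T-∨ h
... | inj₁ px = x , px
... | inj₂ pxs = any-sound p xs pxs

every : ∀ {n} → (Fin n → Bool) → Bool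
every {ℕ.zero}  p = true
every {ℕ.suc n} p = p zero ∧ every (p ∘ suc)

every-sound : ∀ {n} (p : Fin n → Bool) → T (every p) → ∀ i → T (p i)
every-sound {ℕ.suc n} p h zero    = proj₁ (Equivalence.to T-∧ h)
every-sound {ℕ.suc n} p h (suc i) = every-sound (p ∘ suc) (proj₂ (Equivalence.to T-∧ h)) i

some : ∀ {n} → (Fin n → Bool) → Bool
some {ℕ.zero}  p = false
some {ℕ.suc n} p = p zero ∨ some (p ∘ suc)

some-sound : ∀ {n} (p : Fin n → Bool) → T (some p) → ∃ (T ∘ p)
some-sound {ℕ.suc n} p h with Equivalence.to T-∨ h
... | inj₁ p0 = zero , p0
... | inj₂ ps with some-sound (p ∘ suc) ps
...   | i , pi = suc i , pi

-- H_Γ preserves semi-magic boards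

data Swap : Set where
  none swap01 swap02 swap12 : Swap

swap : Swap → Fin 3 → Fin 3
swap none   k                = k
swap swap01 zero             = suc zero
swap swap01 (suc zero)       = zero
swap swap01 (suc (suc zero)) = suc (suc zero)
swap swap02 zero             = suc (suc zero)
swap swap02 (suc zero)       = suc zero
swap swap02 (suc (suc zero)) = zero
swap swap12 zero             = zero
swap swap12 (suc zero)       = suc (suc zero)
swap swap12 (suc (suc zero)) = suc zero

swap-involutive : ∀ s k → swap s (swap s k) ≡ k
swap-involutive none   k                = refl
swap-involutive swap01 zero             = refl
swap-involutive swap01 (suc zero)       = refl
swap-involutive swap01 (suc (suc zero)) = refl
swap-involutive swap02 zero             = refl
swap-involutive swap02 (suc zero)       = refl
swap-involutive swap02 (suc (suc zero)) = refl
swap-involutive swap12 zero             = refl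
swap-involutive swap12 (suc zero)       = refl
swap-involutive swap12 (suc (suc zero)) = refl

sum3-cong : ∀ {f g : Fin 3 → ℕ} → (∀ k → f k ≡ g k) → sum3 f ≡ sum3 g
sum3-cong h = cong₂ _+_ (cong₂ _+_ (h zero) (h (suc zero))) (h (suc (suc zero)))

sum3-swap : ∀ s (f : Fin 3 → ℕ) → sum3 (f ∘ swap s) ≡ sum3 f
sum3-swap none   f = refl
sum3-swap swap01 f = solve 3 (λ a b c → (b :+ a) :+ c := (a :+ b) :+ c) refl (f zero) (f (suc zero)) (f (suc (suc zero)))
  where open +-*-Solver
sum3-swap swap02 f = solve 3 (λ a b c → (c :+ b) :+ a := (a :+ b) :+ c) refl (f zero) (f (suc zero)) (f (suc (suc zero)))
  where open +-*-Solver
sum3-swap swap12 f = solve 3 (λ a b c → (a :+ c) :+ b := (a :+ b) :+ c) refl (f zero) (f (suc zero)) (f (suc (suc zero)))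
  where open +-*-Solver

bandMap : Bool → Fin 3 → Fin 3
bandMap false = id
bandMap true  = sw23

bandMap-involutive : ∀ b I → bandMap b (bandMap b I) ≡ I
bandMap-involutive false I                = refl
bandMap-involutive true  zero             = refl
bandMap-involutive true  (suc zero)       = refl
bandMap-involutive true  (suc (suc zero)) = refl

bandMap-zero : ∀ b → bandMap b zero ≡ zero
bandMap-zero false = refl
bandMap-zero true  = refl

-- Row (or column) permutations induced by the generators other than the transpose.
record LinePermutation : Set where
  field
    ρ            : Fin 9 → Fin 9
    swapsBands   : Bool
    within       : Fin 3 → Swap
    ρ-idx        : ∀ I p → ρ (idx I p) ≡ idx (bandMap swapsBands I) (swap (within I) p)
    ρ-involutive : ∀ k → ρ (ρ k) ≡ k

ExactlyOnce-cong : ∀ {f g : Fin 9 → Fin 9} → (∀ k → f k ≡ g k) → ExactlyOnce f → ExactlyOnce g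
ExactlyOnce-cong f≗g eo v with eo v
... | k , fk≡v , unique = k , trans (sym (f≗g k)) fk≡v , λ k' gk'≡v → unique k' (trans (f≗g k') gk'≡v)

ExactlyOnce-∘-involution : ∀ {f : Fin 9 → Fin 9} (σ : Fin 9 → Fin 9) → (∀ k → σ (σ k) ≡ k) →
                           ExactlyOnce f → ExactlyOnce (f ∘ σ)
ExactlyOnce-∘-involution {f} σ σσ eo v with eo v
... | k , fk≡v , unique =
  σ k , subst (λ z → f z ≡ v) (sym (σσ k)) fk≡v , λ k' e → trans (sym (σσ k')) (cong σ (unique (σ k') e))

permuteLines : LinePermutation → LinePermutation → Board → Board
permuteLines R C B r c = B (LinePermutation.ρ R r) (LinePermutation.ρ C c)

transposeBoard : Board → Board
transposeBoard B r c = B c r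

module _ (R C : LinePermutation) where
  open LinePermutation R renaming (ρ to ρr; swapsBands to βr; within to πr; ρ-idx to ρr-idx; ρ-involutive to ρr-inv)
  open LinePermutation C renaming (ρ to ρc; swapsBands to βc; within to πc; ρ-idx to ρc-idx; ρ-involutive to ρc-inv)

  -- where the cell number k of block (I , J) of the permuted board comes from
  blockCell : Fin 3 → Fin 3 → Fin 9 → Fin 9
  blockCell I J k = combine (swap (πr I) (band k)) (swap (πc J) (offset k))

  blockCell-involutive : ∀ I J k → blockCell I J (blockCell I J k) ≡ k
  blockCell-involutive I J k = begin
    combine (swap (πr I) (band k')) (swap (πc J) (offset k'))
      ≡⟨ split-idx-apply (λ p q → combine (swap (πr I) p) (swap (πc J) q)) _ _ ⟩
    combine (swap (πr I) (swap (πr I) (band k))) (swap (πc J) (swap (πc J) (offset k)))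
      ≡⟨ cong₂ combine (swap-involutive (πr I) (band k)) (swap-involutive (πc J) (offset k)) ⟩
    combine (band k) (offset k)
      ≡⟨ idx-split k ⟩
    k ∎
    where
    open ≡-Reasoning
    k' = blockCell I J k

  blockEntries-permuteLines : ∀ B I J k →
    blockEntries B (bandMap βr I) (bandMap βc J) (blockCell I J k) ≡ blockEntries (permuteLines R C B) I J k
  blockEntries-permuteLines B I J k = begin
    B (idx (bandMap βr I) (band k')) (idx (bandMap βc J) (offset k'))
      ≡⟨ split-idx-apply (λ p q → B (idx (bandMap βr I) p) (idx (bandMap βc J) q)) _ _ ⟩
    B (idx (bandMap βr I) (swap (πr I) (band k))) (idx (bandMap βc J) (swap (πc J) (offset k)))
      ≡⟨ sym (cong₂ B (ρr-idx I (band k)) (ρc-idx J (offset k))) ⟩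
    B (ρr (idx I (band k))) (ρc (idx J (offset k))) ∎
    where
    open ≡-Reasoning
    k' = blockCell I J k

  permuteLines-sudoku : ∀ B → IsSudoku B → IsSudoku (permuteLines R C B)
  permuteLines-sudoku B (rows , cols , blocks) =
      (λ r → ExactlyOnce-∘-involution ρc ρc-inv (rows (ρr r)))
    , (λ c → ExactlyOnce-∘-involution ρr ρr-inv (cols (ρc c)))
    , λ I J → ExactlyOnce-cong (blockEntries-permuteLines B I J)
                (ExactlyOnce-∘-involution (blockCell I J) (blockCell-involutive I J)
                  (blocks (bandMap βr I) (bandMap βc J)))

  permuteLines-sums : ∀ B I J → BlockRowsColsSum12 B (bandMap βr I) (bandMap βc J) →
                      BlockRowsColsSum12 (permuteLines R C B) I J
  permuteLines-sums B I J (rowSums , colSums) =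
      (λ p → trans (sum3-cong (λ q → entry≡ p q))
               (trans (sum3-swap (πc J) (λ q → toℕ (B (idx I' (swap (πr I) p)) (idx J' q))))
                      (rowSums (swap (πr I) p))))
    , (λ q → trans (sum3-cong (λ p → entry≡ p q))
               (trans (sum3-swap (πr I) (λ p → toℕ (B (idx I' p) (idx J' (swap (πc J) q)))))
                      (colSums (swap (πc J) q))))
    where
    I' = bandMap βr I
    J' = bandMap βc J
    entry≡ : ∀ p q → toℕ (permuteLines R C B (idx I p) (idx J q))
                   ≡ toℕ (B (idx I' (swap (πr I) p)) (idx J' (swap (πc J) q)))
    entry≡ p q = cong toℕ (cong₂ B (ρr-idx I p) (ρc-idx J q))

  permuteLines-semiMagic : ∀ B → IsSemiMagicBoard B → IsSemiMagicBoard (permuteLines R C B)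
  permuteLines-semiMagic B (sudoku , sums) =
    permuteLines-sudoku B sudoku , λ I J → permuteLines-sums B I J (sums (bandMap βr I) (bandMap βc J))

transpose-semiMagic : ∀ B → IsSemiMagicBoard B → IsSemiMagicBoard (transposeBoard B)
transpose-semiMagic B ((rows , cols , blocks) , sums) =
  (cols , rows , blocks′) , λ I J → proj₂ (sums J I) , proj₁ (sums J I)
  where
  flip : Fin 9 → Fin 9
  flip k = combine (offset k) (band k)
  flip-involutive : ∀ k → flip (flip k) ≡ k
  flip-involutive k = trans (split-idx-apply (λ p q → combine q p) (offset k) (band k)) (idx-split k)
  blocks′ : ∀ I J → ExactlyOnce (blockEntries (transposeBoard B) I J)
  blocks′ I J = ExactlyOnce-cong
    (λ k → split-idx-apply (λ p q → B (idx J p) (idx I q)) (offset k) (band k))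
    (ExactlyOnce-∘-involution flip flip-involutive (blocks J I))

tr-involutive : ∀ i j k → tr i j (tr i j k) ≡ k
tr-involutive = decide (all? λ i → all? λ j → all? λ k → tr i j (tr i j k) ≟ k) refl

swapBlocks23-involutive : ∀ k → swapBlocks23 (swapBlocks23 k) ≡ k
swapBlocks23-involutive = decide (all? λ k → swapBlocks23 (swapBlocks23 k) ≟ k) refl

swapBlocks23-idx : ∀ I p → swapBlocks23 (idx I p) ≡ idx (sw23 I) p
swapBlocks23-idx = decide (all? λ I → all? λ p → swapBlocks23 (idx I p) ≟ idx (sw23 I) p) refl

swapWithin : Fin 3 → Fin 3 → Fin 3 → Fin 3 → Swap
swapWithin I p q I' with I' ≟ I
... | no _ = none
swapWithin I zero             zero             I' | yes _ = none
swapWithin I zero             (suc zero)       I' | yes _ = swap01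
swapWithin I zero             (suc (suc zero)) I' | yes _ = swap02
swapWithin I (suc zero)       zero             I' | yes _ = swap01
swapWithin I (suc zero)       (suc zero)       I' | yes _ = none
swapWithin I (suc zero)       (suc (suc zero)) I' | yes _ = swap12
swapWithin I (suc (suc zero)) zero             I' | yes _ = swap02
swapWithin I (suc (suc zero)) (suc zero)       I' | yes _ = swap12
swapWithin I (suc (suc zero)) (suc (suc zero)) I' | yes _ = none

tr-idx : ∀ I p q I' p' → tr (idx I p) (idx I q) (idx I' p') ≡ idx I' (swap (swapWithin I p q I') p')
tr-idx = decide (all? λ I → all? λ p → all? λ q → all? λ I' → all? λ p' →
                   tr (idx I p) (idx I q) (idx I' p') ≟ idx I' (swap (swapWithin I p q I') p')) refl

identityLP : LinePermutation
identityLP = record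
  { ρ = id ; swapsBands = false ; within = λ _ → none
  ; ρ-idx = λ _ _ → refl ; ρ-involutive = λ _ → refl }

transpositionLP : Fin 3 → Fin 3 → Fin 3 → LinePermutation
transpositionLP I p q = record
  { ρ = tr (idx I p) (idx I q) ; swapsBands = false ; within = swapWithin I p q
  ; ρ-idx = tr-idx I p q ; ρ-involutive = tr-involutive (idx I p) (idx I q) }

swapBlocks23LP : LinePermutation
swapBlocks23LP = record
  { ρ = swapBlocks23 ; swapsBands = true ; within = λ _ → none
  ; ρ-idx = swapBlocks23-idx ; ρ-involutive = swapBlocks23-involutive }

actGen-semiMagic : ∀ g B → IsSemiMagicBoard B → IsSemiMagicBoard (actGen g B)
actGen-semiMagic transpose       = transpose-semiMagic
actGen-semiMagic (rowSwap I p q) = permuteLines-semiMagic (transpositionLP I p q) identityLP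
actGen-semiMagic (colSwap J p q) = permuteLines-semiMagic identityLP (transpositionLP J p q)
actGen-semiMagic pillarSwap      = permuteLines-semiMagic identityLP swapBlocks23LP
actGen-semiMagic bandSwap        = permuteLines-semiMagic swapBlocks23LP identityLP

act-semiMagic : ∀ w B → IsSemiMagicBoard B → IsSemiMagicBoard (act w B)
act-semiMagic []      B sm = sm
act-semiMagic (g ∷ w) B sm = actGen-semiMagic g (act w B) (act-semiMagic w B sm)

At : Board → Cell → Fin 9
At B (r , c) = B r c

genCell-involutive : ∀ g x → genCell g (genCell g x) ≡ x
genCell-involutive transpose       x       = refl
genCell-involutive (rowSwap I p q) (r , c) = cong (_, c) (tr-involutive (idx I p) (idx I q) r)
genCell-involutive (colSwap J p q) (r , c) = cong (r ,_) (tr-involutive (idx J p) (idx J q) c)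
genCell-involutive pillarSwap      (r , c) = cong (r ,_) (swapBlocks23-involutive c)
genCell-involutive bandSwap        (r , c) = cong (_, c) (swapBlocks23-involutive r)

actGen-involutive : ∀ g B → actGen g (actGen g B) ≈B B
actGen-involutive g B r c = cong (At B) (genCell-involutive g (r , c))

act-cong : ∀ w {B B'} → B ≈B B' → act w B ≈B act w B'
act-cong []      B≈B' = B≈B'
act-cong (g ∷ w) B≈B' r c = act-cong w B≈B' _ _

act-++ : ∀ w v B → act (w ++ v) B ≡ act w (act v B)
act-++ []      v B = refl
act-++ (g ∷ w) v B = cong (actGen g) (act-++ w v B)

act-reverse : ∀ w B → act (reverse w) (act w B) ≈B B
act-reverse []      B r c = refl
act-reverse (g ∷ w) B r c = begin
  act (reverse (g ∷ w)) (act (g ∷ w) B) r c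
    ≡⟨ cong (λ v → act v (act (g ∷ w) B) r c) (unfold-reverse g w) ⟩
  act (reverse w ∷ʳ g) (actGen g (act w B)) r c
    ≡⟨ cong (λ X → X r c) (act-++ (reverse w) (g ∷ []) (actGen g (act w B))) ⟩
  act (reverse w) (actGen g (actGen g (act w B))) r c
    ≡⟨ act-cong (reverse w) (actGen-involutive g (act w B)) r c ⟩
  act (reverse w) (act w B) r c
    ≡⟨ act-reverse w B r c ⟩
  B r c ∎
  where open ≡-Reasoning

≈B-trans : ∀ {B C D} → B ≈B C → C ≈B D → B ≈B D
≈B-trans B≈C C≈D r c = trans (B≈C r c) (C≈D r c)

≈B-sym : ∀ {B C} → B ≈B C → C ≈B B
≈B-sym B≈C r c = sym (B≈C r c)

SameNest-sym : ∀ {B B'} → SameNest B B' → SameNest B' B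
SameNest-sym {B} (w , wB≈B') = reverse w , ≈B-trans (act-cong (reverse w) (≈B-sym wB≈B')) (act-reverse w B)

source : List Gen → Cell → Cell
source []      x = x
source (g ∷ w) x = source w (genCell g x)

act-source : ∀ w B x → At (act w B) x ≡ At B (source w x)
act-source []      B x = refl
act-source (g ∷ w) B x = act-source w B (genCell g x)

-- An H_Γ-invariant

sumBands23 : (Fin 3 → ℕ) → ℕ
sumBands23 f = f (suc zero) + f (suc (suc zero))

sumBands23-cong : ∀ {f g : Fin 3 → ℕ} → (∀ I → f I ≡ g I) → sumBands23 f ≡ sumBands23 g
sumBands23-cong f≗g = cong₂ _+_ (f≗g (suc zero)) (f≗g (suc (suc zero)))

sumBands23-bandMap : ∀ b (f : Fin 3 → ℕ) → sumBands23 (f ∘ bandMap b) ≡ sumBands23 f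
sumBands23-bandMap false f = refl
sumBands23-bandMap true  f = +-comm (f (suc (suc zero))) (f (suc zero))

-- A line permutation fixes the first band setwise and preserves the union of the other two,
-- so sums over pairs (line in the first band, line outside it) are invariant.
crossPairSum : (Fin 9 → Fin 9 → ℕ) → ℕ
crossPairSum H = sum3 λ p → sumBands23 λ I → sum3 λ p' → H (idx zero p) (idx I p')

crossPairSum-cong : ∀ {H H'} → (∀ a b → H a b ≡ H' a b) → crossPairSum H ≡ crossPairSum H'
crossPairSum-cong H≗H' = sum3-cong λ p → sumBands23-cong λ I → sum3-cong λ p' → H≗H' (idx zero p) (idx I p')

crossPairSum-permute : ∀ R H → crossPairSum (λ a b → H (LinePermutation.ρ R a) (LinePermutation.ρ R b)) ≡ crossPairSum H
crossPairSum-permute R H = begin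
  crossPairSum (λ a b → H (ρ a) (ρ b))
    ≡⟨ (sum3-cong λ p → sumBands23-cong λ I → sum3-cong λ p' → cong₂ H (ρ-idx₀ p) (ρ-idx I p')) ⟩
  (sum3 λ p → sumBands23 λ I → sum3 λ p' → H (idx zero (π₀ p)) (idx (bandMap β I) (swap (within I) p')))
    ≡⟨ (sum3-cong λ p → sumBands23-cong λ I →
         sum3-swap (within I) (λ p' → H (idx zero (π₀ p)) (idx (bandMap β I) p'))) ⟩
  (sum3 λ p → sumBands23 λ I → sum3 λ p' → H (idx zero (π₀ p)) (idx (bandMap β I) p'))
    ≡⟨ (sum3-cong λ p → sumBands23-bandMap β (λ I → sum3 λ p' → H (idx zero (π₀ p)) (idx I p'))) ⟩
  (sum3 λ p → sumBands23 λ I → sum3 λ p' → H (idx zero (π₀ p)) (idx I p'))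
    ≡⟨ sum3-swap (within zero) (λ p → sumBands23 λ I → sum3 λ p' → H (idx zero p) (idx I p')) ⟩
  crossPairSum H ∎
  where
  open ≡-Reasoning
  open LinePermutation R renaming (swapsBands to β)
  π₀ = swap (within zero)
  ρ-idx₀ : ∀ p → ρ (idx zero p) ≡ idx zero (π₀ p)
  ρ-idx₀ p = trans (ρ-idx zero p) (cong (λ I → idx I (π₀ p)) (bandMap-zero β))

module RectangleInvariant (weight : Fin 9 → Fin 9 → Fin 9 → Fin 9 → ℕ) where

  corners : Board → Fin 9 → Fin 9 → Fin 9 → Fin 9 → ℕ
  corners B r₀ r₁ c₀ c₁ = weight (B r₀ c₀) (B r₀ c₁) (B r₁ c₀) (B r₁ c₁)

  rectangleSum : Board → ℕ
  rectangleSum B = crossPairSum λ r₀ r₁ → crossPairSum (corners B r₀ r₁)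

  invariant : Board → ℕ
  invariant B = rectangleSum B + rectangleSum (transposeBoard B)

  rectangleSum-permuteLines : ∀ R C B → rectangleSum (permuteLines R C B) ≡ rectangleSum B
  rectangleSum-permuteLines R C B =
    trans (crossPairSum-cong λ r₀ r₁ → crossPairSum-permute C (corners B (ρ R r₀) (ρ R r₁)))
          (crossPairSum-permute R λ r₀ r₁ → crossPairSum (corners B r₀ r₁))
    where open LinePermutation using (ρ)

  invariant-permuteLines : ∀ R C B → invariant (permuteLines R C B) ≡ invariant B
  invariant-permuteLines R C B =
    cong₂ _+_ (rectangleSum-permuteLines R C B) (rectangleSum-permuteLines C R (transposeBoard B))

  invariant-actGen : ∀ g B → invariant (actGen g B) ≡ invariant B
  invariant-actGen transpose       B = +-comm (rectangleSum (transposeBoard B)) (rectangleSum B)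
  invariant-actGen (rowSwap I p q) B = invariant-permuteLines (transpositionLP I p q) identityLP B
  invariant-actGen (colSwap J p q) B = invariant-permuteLines identityLP (transpositionLP J p q) B
  invariant-actGen pillarSwap      B = invariant-permuteLines identityLP swapBlocks23LP B
  invariant-actGen bandSwap        B = invariant-permuteLines swapBlocks23LP identityLP B

  invariant-act : ∀ w B → invariant (act w B) ≡ invariant B
  invariant-act []      B = refl
  invariant-act (g ∷ w) B = trans (invariant-actGen g (act w B)) (invariant-act w B)

  weight-cong : ∀ {a a' b b' c c' d d'} → a ≡ a' → b ≡ b' → c ≡ c' → d ≡ d' → weight a b c d ≡ weight a' b' c' d'
  weight-cong refl refl refl refl = refl

  invariant-cong : ∀ {B B'} → B ≈B B' → invariant B ≡ invariant B'
  invariant-cong {B} {B'} B≈B' = cong₂ _+_ (rectangles B≈B') (rectangles (λ r c → B≈B' c r))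
    where
    rectangles : ∀ {B B'} → B ≈B B' → rectangleSum B ≡ rectangleSum B'
    rectangles B≈B' = crossPairSum-cong λ r₀ r₁ → crossPairSum-cong λ c₀ c₁ →
      weight-cong (B≈B' r₀ c₀) (B≈B' r₀ c₁) (B≈B' r₁ c₀) (B≈B' r₁ c₁)

  invariant-SameNest : ∀ {B B'} → SameNest B B' → invariant B ≡ invariant B'
  invariant-SameNest {B} (w , wB≈B') = trans (sym (invariant-act w B)) (invariant-cong wB≈B')

-- Certified exhaustive search

_⇒ᵇ_ : Bool → Bool → Bool
true  ⇒ᵇ b = b
false ⇒ᵇ _ = true

⇒ᵇ-sound : ∀ {a b} → T (a ⇒ᵇ b) → T a → T b
⇒ᵇ-sound {true} h _ = h

⇒ᵇ-complete : ∀ a {b} → (T a → T b) → T (a ⇒ᵇ b)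
⇒ᵇ-complete true  f = f _
⇒ᵇ-complete false f = _

ExactlyOnce-injective : ∀ {f : Fin 9 → Fin 9} → ExactlyOnce f → ∀ {a b} → f a ≡ f b → a ≡ b
ExactlyOnce-injective {f} eo {a} {b} fa≡fb with eo (f a)
... | _ , _ , unique = trans (unique a refl) (sym (unique b (sym fa≡fb)))

blockEntries-band-offset : ∀ B r c → blockEntries B (band r) (band c) (combine (offset r) (offset c)) ≡ B r c
blockEntries-band-offset B r c =
  trans (split-idx-apply (λ p q → B (idx (band r) p) (idx (band c) q)) (offset r) (offset c))
        (cong₂ B (idx-split r) (idx-split c))

band-offset-injective : ∀ {k k'} → band k ≡ band k' → offset k ≡ offset k' → k ≡ k'
band-offset-injective {k} {k'} same-band same-offset =
  trans (sym (idx-split k)) (trans (cong₂ idx same-band same-offset) (idx-split k'))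

sudoku-block-injective : ∀ {B} → IsSudoku B → ∀ {r c r' c'} → band r ≡ band r' → band c ≡ band c' →
                         B r c ≡ B r' c' → (r , c) ≡ (r' , c')
sudoku-block-injective {B} (_ , _ , blocks) {r} {c} {r'} {c'} same-band-r same-band-c e =
  cong₂ _,_ (band-offset-injective same-band-r (proj₁ same-offsets))
            (band-offset-injective same-band-c (proj₂ same-offsets))
  where
  at' : blockEntries B (band r) (band c) (combine (offset r') (offset c')) ≡ B r' c'
  at' = trans (cong₂ (λ I J → blockEntries B I J (combine (offset r') (offset c'))) same-band-r same-band-c) (blockEntries-band-offset B r' c')
  same-offsets : offset r ≡ offset r' × offset c ≡ offset c'
  same-offsets = combine-injective (offset r) (offset c) (offset r') (offset c')
    (ExactlyOnce-injective (blocks (band r) (band c)) (trans (blockEntries-band-offset B r c) (trans e (sym at'))))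

sameUnit : Cell → Cell → Bool
sameUnit (r , c) (r' , c') = r == r' ∨ c == c' ∨ (band r == band r' ∧ band c == band c')

sudoku-sameUnit-injective : ∀ {B} → IsSudoku B → ∀ x y → T (sameUnit x y) → At B x ≡ At B y → x ≡ y
sudoku-sameUnit-injective {B} sudoku@(rows , cols , _) (r , c) (r' , c') same e
  with Equivalence.to T-∨ same
... | inj₁ r≡r′ with refl ← ==-sound {x = r} {r'} r≡r′ = cong (r ,_) (ExactlyOnce-injective (rows r) e)
... | inj₂ same′ with Equivalence.to T-∨ same′
...   | inj₁ c≡c′ with refl ← ==-sound {x = c} {c'} c≡c′ = cong (_, c) (ExactlyOnce-injective (cols c) e)
...   | inj₂ same-block with Equivalence.to T-∧ same-block
...     | bands , pillars = sudoku-block-injective sudoku (==-sound bands) (==-sound pillars) e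

Assignment : Set
Assignment = List (Cell × Fin 9)

infix 4 _⊨_
_⊨_ : Board → Assignment → Set
B ⊨ a = All (λ xv → At B (proj₁ xv) ≡ proj₂ xv) a

_==ᶜ_ : Cell → Cell → Bool
x ==ᶜ y = proj₁ x == proj₁ y ∧ proj₂ x == proj₂ y

==ᶜ-sound : ∀ {x y} → T (x ==ᶜ y) → x ≡ y
==ᶜ-sound h = cong₂ _,_ (==-sound (proj₁ (Equivalence.to T-∧ h))) (==-sound (proj₂ (Equivalence.to T-∧ h)))

==ᶜ-refl : ∀ x → T (x ==ᶜ x)
==ᶜ-refl x = Equivalence.from T-∧ (==-refl (proj₁ x) , ==-refl (proj₂ x))

valueAt : Assignment → Cell → Maybe (Fin 9)
valueAt []            y = nothing
valueAt ((x , v) ∷ a) y = if x ==ᶜ y then just v else valueAt a y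

valueAt-⊨ : ∀ {B} a → B ⊨ a → ∀ y → Maybe.All (At B y ≡_) (valueAt a y)
valueAt-⊨             []            []          y = Maybe.nothing
valueAt-⊨ {B} ((x , v) ∷ a) (Bx≡v ∷ h) y with x ==ᶜ y in x==y
... | true  = Maybe.just (trans (cong (At B) (sym (==ᶜ-sound (Equivalence.from T-≡ x==y)))) Bx≡v)
... | false = valueAt-⊨ a h y

_≐_ : Maybe (Fin 9) → Fin 9 → Bool
just v  ≐ u = v == u
nothing ≐ u = false

≐-sound : ∀ {v m u} → Maybe.All (v ≡_) m → T (m ≐ u) → v ≡ u
≐-sound (Maybe.just v≡w) w==u = trans v≡w (==-sound w==u)

segmentSum12 : Maybe (Fin 9) → Maybe (Fin 9) → Maybe (Fin 9) → Bool
segmentSum12 (just a) (just b) (just c) = toℕ a + toℕ b + toℕ c ≡ᵇ 12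
segmentSum12 _        _        _        = true

segmentSum12-complete : ∀ {a b c m₀ m₁ m₂} → Maybe.All (a ≡_) m₀ → Maybe.All (b ≡_) m₁ → Maybe.All (c ≡_) m₂ →
                        toℕ a + toℕ b + toℕ c ≡ 12 → T (segmentSum12 m₀ m₁ m₂)
segmentSum12-complete Maybe.nothing  _              _              _ = _
segmentSum12-complete (Maybe.just _) Maybe.nothing  _              _ = _
segmentSum12-complete (Maybe.just _) (Maybe.just _) Maybe.nothing  _ = _
segmentSum12-complete {a} {b} {c} (Maybe.just refl) (Maybe.just refl) (Maybe.just refl) sum≡12 = ≡⇒≡ᵇ (toℕ a + toℕ b + toℕ c) 12 sum≡12

blockRowSum : ∀ {B} → IsSemiMagicBoard B → ∀ r c → sum3 (λ q → toℕ (B r (idx (band c) q))) ≡ 12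
blockRowSum {B} (_ , sums) r c =
  subst (λ r → sum3 (λ q → toℕ (B r (idx (band c) q))) ≡ 12) (idx-split r) (proj₁ (sums (band r) (band c)) (offset r))

blockColumnSum : ∀ {B} → IsSemiMagicBoard B → ∀ r c → sum3 (λ p → toℕ (B (idx (band r) p) c)) ≡ 12
blockColumnSum {B} (_ , sums) r c =
  subst (λ c → sum3 (λ p → toℕ (B (idx (band r) p) c)) ≡ 12) (idx-split c) (proj₂ (sums (band r) (band c)) (offset c))

blockLinesSum12 : Assignment → Cell → Bool
blockLinesSum12 a (r , c) =
  segmentSum12 (valueAt a (r , idx (band c) zero)) (valueAt a (r , idx (band c) (suc zero))) (valueAt a (r , idx (band c) (suc (suc zero))))
  ∧ segmentSum12 (valueAt a (idx (band r) zero , c)) (valueAt a (idx (band r) (suc zero) , c)) (valueAt a (idx (band r) (suc (suc zero)) , c))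

blockLinesSum12-complete : ∀ {B} → IsSemiMagicBoard B → ∀ a → B ⊨ a → ∀ x → T (blockLinesSum12 a x)
blockLinesSum12-complete sm a h (r , c) = Equivalence.from T-∧
  ( segmentSum12-complete (known _) (known _) (known _) (blockRowSum sm r c)
  , segmentSum12-complete (known _) (known _) (known _) (blockColumnSum sm r c) )
  where known = valueAt-⊨ a h

consistent : Cell → Fin 9 → Assignment → Bool
consistent x v []            = true
consistent x v ((y , u) ∷ a) = ((sameUnit x y ∧ v == u) ⇒ᵇ x ==ᶜ y) ∧ consistent x v a

consistent-complete : ∀ {B} → IsSudoku B → ∀ x a → B ⊨ a → T (consistent x (At B x) a)
consistent-complete         sudoku x []            []           = _
consistent-complete {B} sudoku x ((y , u) ∷ a) (By≡u ∷ h) =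
  Equivalence.from T-∧ (⇒ᵇ-complete (sameUnit x y ∧ At B x == u) clash⇒same , consistent-complete sudoku x a h)
  where
  clash⇒same : T (sameUnit x y ∧ At B x == u) → T (x ==ᶜ y)
  clash⇒same clash with same , Bx==u ← Equivalence.to T-∧ clash =
    subst (λ z → T (x ==ᶜ z)) (sudoku-sameUnit-injective sudoku x y same (trans (==-sound Bx==u) (sym By≡u))) (==ᶜ-refl x)

admissible : Cell → Fin 9 → Assignment → Bool
admissible x v a = consistent x v a ∧ blockLinesSum12 ((x , v) ∷ a) x

admissible-complete : ∀ {B} → IsSemiMagicBoard B → ∀ x a → B ⊨ a → T (admissible x (At B x) a)
admissible-complete {B} sm x a h =
  Equivalence.from T-∧ (consistent-complete (proj₁ sm) x a h , blockLinesSum12-complete sm ((x , At B x) ∷ a) (refl ∷ h) x)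

search : (Assignment → Bool) → List Cell → Assignment → Bool
search leaf []       a = leaf a
search leaf (x ∷ xs) a = every λ v → admissible x v a ⇒ᵇ search leaf xs ((x , v) ∷ a)

search-sound : ∀ leaf {B} → IsSemiMagicBoard B → ∀ xs a → B ⊨ a → T (search leaf xs a) →
               ∃ λ a' → B ⊨ a' × T (leaf a')
search-sound leaf sm []       a h s = a , h , s
search-sound leaf {B} sm (x ∷ xs) a h s =
  search-sound leaf sm xs ((x , At B x) ∷ a) (refl ∷ h)
    (⇒ᵇ-sound (every-sound (λ v → admissible x v a ⇒ᵇ search leaf xs ((x , v) ∷ a)) s (At B x))
              (admissible-complete sm x a h))

reachableBy : List (List Gen) → Assignment → Assignment → Bool
reachableBy ws target a = any (λ w → all (λ yu → valueAt a (source w (proj₁ yu)) ≐ proj₂ yu) target) ws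

reachableBy-sound : ∀ {B} ws target a → B ⊨ a → T (reachableBy ws target a) → ∃ λ w → act w B ⊨ target
reachableBy-sound {B} ws target a h reachable with any-sound _ ws reachable
... | w , moves = w , All.map moved (all-sound _ target moves)
  where
  moved : ∀ {yu} → T (valueAt a (source w (proj₁ yu)) ≐ proj₂ yu) → At (act w B) (proj₁ yu) ≡ proj₂ yu
  moved {y , u} known = trans (act-source w B y) (≐-sound (valueAt-⊨ a h (source w y)) known)

record _⇝_ (P Q : Board → Set) : Set where
  field move : ∀ B → IsSemiMagicBoard B → P B → ∃ λ w → Q (act w B)
open _⇝_ public

⇝-trans : ∀ {P Q R} → P ⇝ Q → Q ⇝ R → P ⇝ R
move (⇝-trans {R = R} P⇝Q Q⇝R) B sm pB with move P⇝Q B sm pB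
... | w₁ , qB with move Q⇝R (act w₁ B) (act-semiMagic w₁ B sm) qB
...   | w₂ , rB = w₂ ++ w₁ , subst R (sym (act-++ w₂ w₁ B)) rB

⇝-map : ∀ {P Q R} → (∀ {B} → Q B → R B) → P ⇝ Q → P ⇝ R
move (⇝-map Q⇒R P⇝Q) B sm pB with move P⇝Q B sm pB
... | w , qB = w , Q⇒R qB

search-reachableBy : ∀ ws target xs start → search (reachableBy ws target) xs start ≡ true → (_⊨ start) ⇝ (_⊨ target)
move (search-reachableBy ws target xs start s) B sm h
  with search-sound (reachableBy ws target) sm xs start h (Equivalence.from T-≡ s)
... | a , ha , reachable = reachableBy-sound ws target a ha reachable

inCatalogue : ∀ {n} → (Fin n → Board) → Assignment → Bool
inCatalogue N a = some λ i → every λ r → every λ c → valueAt a (r , c) ≐ N i r c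

search-inCatalogue : ∀ {n} (N : Fin n → Board) xs start → search (inCatalogue N) xs start ≡ true →
                     ∀ B → IsSemiMagicBoard B → B ⊨ start → ∃ λ i → B ≈B N i
search-inCatalogue N xs start s B sm h with search-sound (inCatalogue N) sm xs start h (Equivalence.from T-≡ s)
... | a , ha , found with some-sound _ found
...   | i , agrees = i , λ r c →
  ≐-sound (valueAt-⊨ a ha (r , c))
    (every-sound (λ c → valueAt a (r , c) ≐ N i r c)
      (every-sound (λ r → every λ c → valueAt a (r , c) ≐ N i r c) agrees r) c)

exactlyOnce? : ∀ f → Dec (ExactlyOnce f)
exactlyOnce? f = all? λ v → any? λ k → f k ≟ v ×-dec all? λ k' → f k' ≟ v →-dec k' ≟ k

sudoku? : ∀ B → Dec (IsSudoku B)
sudoku? B = (all? λ r → exactlyOnce? (B r)) ×-dec (all? λ c → exactlyOnce? (λ r → B r c))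
       ×-dec (all? λ I → all? λ J → exactlyOnce? (blockEntries B I J))

blockRowsColsSum12? : ∀ B I J → Dec (BlockRowsColsSum12 B I J)
blockRowsColsSum12? B I J = (all? λ p → sum3 (λ q → toℕ (B (idx I p) (idx J q))) ℕ.≟ 12)
                      ×-dec (all? λ q → sum3 (λ p → toℕ (B (idx I p) (idx J q))) ℕ.≟ 12)

semiMagic? : ∀ B → Dec (IsSemiMagicBoard B)
semiMagic? B = sudoku? B ×-dec all? λ I → all? λ J → blockRowsColsSum12? B I J

-- The sixteen nests

permutationWords : (Fin 3 → Fin 3 → Gen) → List (List Gen)
permutationWords g = [] ∷ (s₀₁ ∷ []) ∷ (s₁₂ ∷ []) ∷ (s₀₁ ∷ s₁₂ ∷ []) ∷ (s₁₂ ∷ s₀₁ ∷ []) ∷ (s₀₁ ∷ s₁₂ ∷ s₀₁ ∷ []) ∷ []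
  where
  s₀₁ = g zero (suc zero)
  s₁₂ = g (suc zero) (suc (suc zero))

infixr 5 _⊗_
_⊗_ : List (List Gen) → List (List Gen) → List (List Gen)
ws ⊗ vs = concatMap (λ w → map (w ++_) vs) ws

-- Words realising every rearrangement by H_Γ of the first block; of the first band fixing the
-- first block; of the first pillar fixing the first band.
firstBlockWords firstBandWords firstPillarWords : List (List Gen)
firstBlockWords  = ([] ∷ (transpose ∷ []) ∷ []) ⊗ permutationWords (rowSwap zero) ⊗ permutationWords (colSwap zero)
firstBandWords   = permutationWords (colSwap (suc zero)) ⊗ permutationWords (colSwap (suc (suc zero))) ⊗ ([] ∷ (pillarSwap ∷ []) ∷ [])
firstPillarWords = permutationWords (rowSwap (suc zero)) ⊗ permutationWords (rowSwap (suc (suc zero))) ⊗ ([] ∷ (bandSwap ∷ []) ∷ [])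

blockCells : Fin 3 → Fin 3 → List Cell
blockCells I J =
    (idx I zero , idx J zero) ∷ (idx I zero , idx J (suc zero)) ∷ (idx I zero , idx J (suc (suc zero)))
  ∷ (idx I (suc zero) , idx J zero) ∷ (idx I (suc zero) , idx J (suc zero)) ∷ (idx I (suc zero) , idx J (suc (suc zero)))
  ∷ (idx I (suc (suc zero)) , idx J zero) ∷ (idx I (suc (suc zero)) , idx J (suc zero)) ∷ (idx I (suc (suc zero)) , idx J (suc (suc zero)))
  ∷ []

firstBlockCells otherFirstBandCells otherFirstPillarCells nonGnomonCells : List Cell
firstBlockCells       = blockCells zero zero
otherFirstBandCells   = blockCells zero (suc zero) ++ blockCells zero (suc (suc zero))
otherFirstPillarCells = blockCells (suc zero) zero ++ blockCells (suc (suc zero)) zero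
nonGnomonCells        = blockCells (suc zero) (suc zero) ++ blockCells (suc zero) (suc (suc zero))
                     ++ blockCells (suc (suc zero)) (suc zero) ++ blockCells (suc (suc zero)) (suc (suc zero))

-- the catch-all clause serves 0; catalogueTable has no entry above 8
digit : ℕ → Fin 9
digit 1 = suc zero
digit 2 = suc (suc zero)
digit 3 = suc (suc (suc zero))
digit 4 = suc (suc (suc (suc zero)))
digit 5 = suc (suc (suc (suc (suc zero))))
digit 6 = suc (suc (suc (suc (suc (suc zero)))))
digit 7 = suc (suc (suc (suc (suc (suc (suc zero))))))
digit 8 = suc (suc (suc (suc (suc (suc (suc (suc zero)))))))
digit _ = zero

catalogueTable : Vec (Vec (Vec ℕ 9) 9) 16
catalogueTable =
    ( (0 ∷ 4 ∷ 8 ∷ 7 ∷ 2 ∷ 3 ∷ 5 ∷ 6 ∷ 1 ∷ [])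
      ∷ (5 ∷ 6 ∷ 1 ∷ 0 ∷ 4 ∷ 8 ∷ 7 ∷ 2 ∷ 3 ∷ [])
      ∷ (7 ∷ 2 ∷ 3 ∷ 5 ∷ 6 ∷ 1 ∷ 0 ∷ 4 ∷ 8 ∷ [])
      ∷ (8 ∷ 0 ∷ 4 ∷ 1 ∷ 5 ∷ 6 ∷ 2 ∷ 3 ∷ 7 ∷ [])
      ∷ (1 ∷ 5 ∷ 6 ∷ 3 ∷ 7 ∷ 2 ∷ 4 ∷ 8 ∷ 0 ∷ [])
      ∷ (3 ∷ 7 ∷ 2 ∷ 8 ∷ 0 ∷ 4 ∷ 6 ∷ 1 ∷ 5 ∷ [])
      ∷ (4 ∷ 8 ∷ 0 ∷ 2 ∷ 3 ∷ 7 ∷ 1 ∷ 5 ∷ 6 ∷ [])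
      ∷ (6 ∷ 1 ∷ 5 ∷ 4 ∷ 8 ∷ 0 ∷ 3 ∷ 7 ∷ 2 ∷ [])
      ∷ (2 ∷ 3 ∷ 7 ∷ 6 ∷ 1 ∷ 5 ∷ 8 ∷ 0 ∷ 4 ∷ [])
      ∷ [])
  ∷ ( (0 ∷ 4 ∷ 8 ∷ 7 ∷ 2 ∷ 3 ∷ 5 ∷ 6 ∷ 1 ∷ [])
      ∷ (5 ∷ 6 ∷ 1 ∷ 0 ∷ 4 ∷ 8 ∷ 7 ∷ 2 ∷ 3 ∷ [])
      ∷ (7 ∷ 2 ∷ 3 ∷ 5 ∷ 6 ∷ 1 ∷ 0 ∷ 4 ∷ 8 ∷ [])
      ∷ (8 ∷ 0 ∷ 4 ∷ 1 ∷ 5 ∷ 6 ∷ 2 ∷ 3 ∷ 7 ∷ [])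
      ∷ (1 ∷ 5 ∷ 6 ∷ 3 ∷ 7 ∷ 2 ∷ 4 ∷ 8 ∷ 0 ∷ [])
      ∷ (3 ∷ 7 ∷ 2 ∷ 8 ∷ 0 ∷ 4 ∷ 6 ∷ 1 ∷ 5 ∷ [])
      ∷ (4 ∷ 8 ∷ 0 ∷ 6 ∷ 1 ∷ 5 ∷ 3 ∷ 7 ∷ 2 ∷ [])
      ∷ (6 ∷ 1 ∷ 5 ∷ 2 ∷ 3 ∷ 7 ∷ 8 ∷ 0 ∷ 4 ∷ [])
      ∷ (2 ∷ 3 ∷ 7 ∷ 4 ∷ 8 ∷ 0 ∷ 1 ∷ 5 ∷ 6 ∷ [])
      ∷ [])
  ∷ ( (0 ∷ 4 ∷ 8 ∷ 7 ∷ 2 ∷ 3 ∷ 5 ∷ 6 ∷ 1 ∷ [])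
      ∷ (5 ∷ 6 ∷ 1 ∷ 0 ∷ 4 ∷ 8 ∷ 7 ∷ 2 ∷ 3 ∷ [])
      ∷ (7 ∷ 2 ∷ 3 ∷ 5 ∷ 6 ∷ 1 ∷ 0 ∷ 4 ∷ 8 ∷ [])
      ∷ (8 ∷ 0 ∷ 4 ∷ 1 ∷ 5 ∷ 6 ∷ 3 ∷ 7 ∷ 2 ∷ [])
      ∷ (1 ∷ 5 ∷ 6 ∷ 3 ∷ 7 ∷ 2 ∷ 8 ∷ 0 ∷ 4 ∷ [])
      ∷ (3 ∷ 7 ∷ 2 ∷ 8 ∷ 0 ∷ 4 ∷ 1 ∷ 5 ∷ 6 ∷ [])
      ∷ (4 ∷ 8 ∷ 0 ∷ 2 ∷ 3 ∷ 7 ∷ 6 ∷ 1 ∷ 5 ∷ [])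
      ∷ (6 ∷ 1 ∷ 5 ∷ 4 ∷ 8 ∷ 0 ∷ 2 ∷ 3 ∷ 7 ∷ [])
      ∷ (2 ∷ 3 ∷ 7 ∷ 6 ∷ 1 ∷ 5 ∷ 4 ∷ 8 ∷ 0 ∷ [])
      ∷ [])
  ∷ ( (0 ∷ 4 ∷ 8 ∷ 7 ∷ 2 ∷ 3 ∷ 5 ∷ 6 ∷ 1 ∷ [])
      ∷ (5 ∷ 6 ∷ 1 ∷ 0 ∷ 4 ∷ 8 ∷ 7 ∷ 2 ∷ 3 ∷ [])
      ∷ (7 ∷ 2 ∷ 3 ∷ 5 ∷ 6 ∷ 1 ∷ 0 ∷ 4 ∷ 8 ∷ [])
      ∷ (8 ∷ 0 ∷ 4 ∷ 1 ∷ 5 ∷ 6 ∷ 3 ∷ 7 ∷ 2 ∷ [])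
      ∷ (1 ∷ 5 ∷ 6 ∷ 3 ∷ 7 ∷ 2 ∷ 8 ∷ 0 ∷ 4 ∷ [])
      ∷ (3 ∷ 7 ∷ 2 ∷ 8 ∷ 0 ∷ 4 ∷ 1 ∷ 5 ∷ 6 ∷ [])
      ∷ (4 ∷ 8 ∷ 0 ∷ 6 ∷ 1 ∷ 5 ∷ 2 ∷ 3 ∷ 7 ∷ [])
      ∷ (6 ∷ 1 ∷ 5 ∷ 2 ∷ 3 ∷ 7 ∷ 4 ∷ 8 ∷ 0 ∷ [])
      ∷ (2 ∷ 3 ∷ 7 ∷ 4 ∷ 8 ∷ 0 ∷ 6 ∷ 1 ∷ 5 ∷ [])
      ∷ [])
  ∷ ( (0 ∷ 4 ∷ 8 ∷ 7 ∷ 2 ∷ 3 ∷ 5 ∷ 6 ∷ 1 ∷ [])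
      ∷ (5 ∷ 6 ∷ 1 ∷ 0 ∷ 4 ∷ 8 ∷ 7 ∷ 2 ∷ 3 ∷ [])
      ∷ (7 ∷ 2 ∷ 3 ∷ 5 ∷ 6 ∷ 1 ∷ 0 ∷ 4 ∷ 8 ∷ [])
      ∷ (8 ∷ 0 ∷ 4 ∷ 2 ∷ 3 ∷ 7 ∷ 1 ∷ 5 ∷ 6 ∷ [])
      ∷ (1 ∷ 5 ∷ 6 ∷ 4 ∷ 8 ∷ 0 ∷ 3 ∷ 7 ∷ 2 ∷ [])
      ∷ (3 ∷ 7 ∷ 2 ∷ 6 ∷ 1 ∷ 5 ∷ 8 ∷ 0 ∷ 4 ∷ [])
      ∷ (4 ∷ 8 ∷ 0 ∷ 1 ∷ 5 ∷ 6 ∷ 2 ∷ 3 ∷ 7 ∷ [])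
      ∷ (6 ∷ 1 ∷ 5 ∷ 3 ∷ 7 ∷ 2 ∷ 4 ∷ 8 ∷ 0 ∷ [])
      ∷ (2 ∷ 3 ∷ 7 ∷ 8 ∷ 0 ∷ 4 ∷ 6 ∷ 1 ∷ 5 ∷ [])
      ∷ [])
  ∷ ( (0 ∷ 4 ∷ 8 ∷ 7 ∷ 2 ∷ 3 ∷ 5 ∷ 6 ∷ 1 ∷ [])
      ∷ (5 ∷ 6 ∷ 1 ∷ 0 ∷ 4 ∷ 8 ∷ 7 ∷ 2 ∷ 3 ∷ [])
      ∷ (7 ∷ 2 ∷ 3 ∷ 5 ∷ 6 ∷ 1 ∷ 0 ∷ 4 ∷ 8 ∷ [])
      ∷ (8 ∷ 0 ∷ 4 ∷ 2 ∷ 3 ∷ 7 ∷ 1 ∷ 5 ∷ 6 ∷ [])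
      ∷ (1 ∷ 5 ∷ 6 ∷ 4 ∷ 8 ∷ 0 ∷ 3 ∷ 7 ∷ 2 ∷ [])
      ∷ (3 ∷ 7 ∷ 2 ∷ 6 ∷ 1 ∷ 5 ∷ 8 ∷ 0 ∷ 4 ∷ [])
      ∷ (4 ∷ 8 ∷ 0 ∷ 3 ∷ 7 ∷ 2 ∷ 6 ∷ 1 ∷ 5 ∷ [])
      ∷ (6 ∷ 1 ∷ 5 ∷ 8 ∷ 0 ∷ 4 ∷ 2 ∷ 3 ∷ 7 ∷ [])
      ∷ (2 ∷ 3 ∷ 7 ∷ 1 ∷ 5 ∷ 6 ∷ 4 ∷ 8 ∷ 0 ∷ [])
      ∷ [])
  ∷ ( (0 ∷ 4 ∷ 8 ∷ 7 ∷ 2 ∷ 3 ∷ 5 ∷ 6 ∷ 1 ∷ [])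
      ∷ (5 ∷ 6 ∷ 1 ∷ 0 ∷ 4 ∷ 8 ∷ 7 ∷ 2 ∷ 3 ∷ [])
      ∷ (7 ∷ 2 ∷ 3 ∷ 5 ∷ 6 ∷ 1 ∷ 0 ∷ 4 ∷ 8 ∷ [])
      ∷ (8 ∷ 0 ∷ 4 ∷ 2 ∷ 3 ∷ 7 ∷ 6 ∷ 1 ∷ 5 ∷ [])
      ∷ (1 ∷ 5 ∷ 6 ∷ 4 ∷ 8 ∷ 0 ∷ 2 ∷ 3 ∷ 7 ∷ [])
      ∷ (3 ∷ 7 ∷ 2 ∷ 6 ∷ 1 ∷ 5 ∷ 4 ∷ 8 ∷ 0 ∷ [])
      ∷ (4 ∷ 8 ∷ 0 ∷ 1 ∷ 5 ∷ 6 ∷ 3 ∷ 7 ∷ 2 ∷ [])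
      ∷ (6 ∷ 1 ∷ 5 ∷ 3 ∷ 7 ∷ 2 ∷ 8 ∷ 0 ∷ 4 ∷ [])
      ∷ (2 ∷ 3 ∷ 7 ∷ 8 ∷ 0 ∷ 4 ∷ 1 ∷ 5 ∷ 6 ∷ [])
      ∷ [])
  ∷ ( (0 ∷ 4 ∷ 8 ∷ 7 ∷ 2 ∷ 3 ∷ 5 ∷ 6 ∷ 1 ∷ [])
      ∷ (5 ∷ 6 ∷ 1 ∷ 0 ∷ 4 ∷ 8 ∷ 7 ∷ 2 ∷ 3 ∷ [])
      ∷ (7 ∷ 2 ∷ 3 ∷ 5 ∷ 6 ∷ 1 ∷ 0 ∷ 4 ∷ 8 ∷ [])
      ∷ (8 ∷ 0 ∷ 4 ∷ 2 ∷ 3 ∷ 7 ∷ 6 ∷ 1 ∷ 5 ∷ [])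
      ∷ (1 ∷ 5 ∷ 6 ∷ 4 ∷ 8 ∷ 0 ∷ 2 ∷ 3 ∷ 7 ∷ [])
      ∷ (3 ∷ 7 ∷ 2 ∷ 6 ∷ 1 ∷ 5 ∷ 4 ∷ 8 ∷ 0 ∷ [])
      ∷ (4 ∷ 8 ∷ 0 ∷ 3 ∷ 7 ∷ 2 ∷ 1 ∷ 5 ∷ 6 ∷ [])
      ∷ (6 ∷ 1 ∷ 5 ∷ 8 ∷ 0 ∷ 4 ∷ 3 ∷ 7 ∷ 2 ∷ [])
      ∷ (2 ∷ 3 ∷ 7 ∷ 1 ∷ 5 ∷ 6 ∷ 8 ∷ 0 ∷ 4 ∷ [])
      ∷ [])
  ∷ ( (0 ∷ 4 ∷ 8 ∷ 7 ∷ 2 ∷ 3 ∷ 5 ∷ 6 ∷ 1 ∷ [])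
      ∷ (5 ∷ 6 ∷ 1 ∷ 0 ∷ 4 ∷ 8 ∷ 7 ∷ 2 ∷ 3 ∷ [])
      ∷ (7 ∷ 2 ∷ 3 ∷ 5 ∷ 6 ∷ 1 ∷ 0 ∷ 4 ∷ 8 ∷ [])
      ∷ (8 ∷ 0 ∷ 4 ∷ 3 ∷ 7 ∷ 2 ∷ 1 ∷ 5 ∷ 6 ∷ [])
      ∷ (1 ∷ 5 ∷ 6 ∷ 8 ∷ 0 ∷ 4 ∷ 3 ∷ 7 ∷ 2 ∷ [])
      ∷ (3 ∷ 7 ∷ 2 ∷ 1 ∷ 5 ∷ 6 ∷ 8 ∷ 0 ∷ 4 ∷ [])
      ∷ (4 ∷ 8 ∷ 0 ∷ 2 ∷ 3 ∷ 7 ∷ 6 ∷ 1 ∷ 5 ∷ [])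
      ∷ (6 ∷ 1 ∷ 5 ∷ 4 ∷ 8 ∷ 0 ∷ 2 ∷ 3 ∷ 7 ∷ [])
      ∷ (2 ∷ 3 ∷ 7 ∷ 6 ∷ 1 ∷ 5 ∷ 4 ∷ 8 ∷ 0 ∷ [])
      ∷ [])
  ∷ ( (0 ∷ 4 ∷ 8 ∷ 7 ∷ 2 ∷ 3 ∷ 5 ∷ 6 ∷ 1 ∷ [])
      ∷ (5 ∷ 6 ∷ 1 ∷ 0 ∷ 4 ∷ 8 ∷ 7 ∷ 2 ∷ 3 ∷ [])
      ∷ (7 ∷ 2 ∷ 3 ∷ 5 ∷ 6 ∷ 1 ∷ 0 ∷ 4 ∷ 8 ∷ [])
      ∷ (8 ∷ 0 ∷ 4 ∷ 3 ∷ 7 ∷ 2 ∷ 1 ∷ 5 ∷ 6 ∷ [])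
      ∷ (1 ∷ 5 ∷ 6 ∷ 8 ∷ 0 ∷ 4 ∷ 3 ∷ 7 ∷ 2 ∷ [])
      ∷ (3 ∷ 7 ∷ 2 ∷ 1 ∷ 5 ∷ 6 ∷ 8 ∷ 0 ∷ 4 ∷ [])
      ∷ (4 ∷ 8 ∷ 0 ∷ 6 ∷ 1 ∷ 5 ∷ 2 ∷ 3 ∷ 7 ∷ [])
      ∷ (6 ∷ 1 ∷ 5 ∷ 2 ∷ 3 ∷ 7 ∷ 4 ∷ 8 ∷ 0 ∷ [])
      ∷ (2 ∷ 3 ∷ 7 ∷ 4 ∷ 8 ∷ 0 ∷ 6 ∷ 1 ∷ 5 ∷ [])
      ∷ [])
  ∷ ( (0 ∷ 4 ∷ 8 ∷ 7 ∷ 2 ∷ 3 ∷ 5 ∷ 6 ∷ 1 ∷ [])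
      ∷ (5 ∷ 6 ∷ 1 ∷ 0 ∷ 4 ∷ 8 ∷ 7 ∷ 2 ∷ 3 ∷ [])
      ∷ (7 ∷ 2 ∷ 3 ∷ 5 ∷ 6 ∷ 1 ∷ 0 ∷ 4 ∷ 8 ∷ [])
      ∷ (8 ∷ 0 ∷ 4 ∷ 3 ∷ 7 ∷ 2 ∷ 6 ∷ 1 ∷ 5 ∷ [])
      ∷ (1 ∷ 5 ∷ 6 ∷ 8 ∷ 0 ∷ 4 ∷ 2 ∷ 3 ∷ 7 ∷ [])
      ∷ (3 ∷ 7 ∷ 2 ∷ 1 ∷ 5 ∷ 6 ∷ 4 ∷ 8 ∷ 0 ∷ [])
      ∷ (4 ∷ 8 ∷ 0 ∷ 2 ∷ 3 ∷ 7 ∷ 1 ∷ 5 ∷ 6 ∷ [])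
      ∷ (6 ∷ 1 ∷ 5 ∷ 4 ∷ 8 ∷ 0 ∷ 3 ∷ 7 ∷ 2 ∷ [])
      ∷ (2 ∷ 3 ∷ 7 ∷ 6 ∷ 1 ∷ 5 ∷ 8 ∷ 0 ∷ 4 ∷ [])
      ∷ [])
  ∷ ( (0 ∷ 4 ∷ 8 ∷ 7 ∷ 2 ∷ 3 ∷ 5 ∷ 6 ∷ 1 ∷ [])
      ∷ (5 ∷ 6 ∷ 1 ∷ 0 ∷ 4 ∷ 8 ∷ 7 ∷ 2 ∷ 3 ∷ [])
      ∷ (7 ∷ 2 ∷ 3 ∷ 5 ∷ 6 ∷ 1 ∷ 0 ∷ 4 ∷ 8 ∷ [])
      ∷ (8 ∷ 0 ∷ 4 ∷ 3 ∷ 7 ∷ 2 ∷ 6 ∷ 1 ∷ 5 ∷ [])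
      ∷ (1 ∷ 5 ∷ 6 ∷ 8 ∷ 0 ∷ 4 ∷ 2 ∷ 3 ∷ 7 ∷ [])
      ∷ (3 ∷ 7 ∷ 2 ∷ 1 ∷ 5 ∷ 6 ∷ 4 ∷ 8 ∷ 0 ∷ [])
      ∷ (4 ∷ 8 ∷ 0 ∷ 6 ∷ 1 ∷ 5 ∷ 3 ∷ 7 ∷ 2 ∷ [])
      ∷ (6 ∷ 1 ∷ 5 ∷ 2 ∷ 3 ∷ 7 ∷ 8 ∷ 0 ∷ 4 ∷ [])
      ∷ (2 ∷ 3 ∷ 7 ∷ 4 ∷ 8 ∷ 0 ∷ 1 ∷ 5 ∷ 6 ∷ [])
      ∷ [])
  ∷ ( (0 ∷ 4 ∷ 8 ∷ 7 ∷ 2 ∷ 3 ∷ 5 ∷ 6 ∷ 1 ∷ [])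
      ∷ (5 ∷ 6 ∷ 1 ∷ 0 ∷ 4 ∷ 8 ∷ 7 ∷ 2 ∷ 3 ∷ [])
      ∷ (7 ∷ 2 ∷ 3 ∷ 5 ∷ 6 ∷ 1 ∷ 0 ∷ 4 ∷ 8 ∷ [])
      ∷ (8 ∷ 0 ∷ 4 ∷ 6 ∷ 1 ∷ 5 ∷ 2 ∷ 3 ∷ 7 ∷ [])
      ∷ (1 ∷ 5 ∷ 6 ∷ 2 ∷ 3 ∷ 7 ∷ 4 ∷ 8 ∷ 0 ∷ [])
      ∷ (3 ∷ 7 ∷ 2 ∷ 4 ∷ 8 ∷ 0 ∷ 6 ∷ 1 ∷ 5 ∷ [])
      ∷ (4 ∷ 8 ∷ 0 ∷ 1 ∷ 5 ∷ 6 ∷ 3 ∷ 7 ∷ 2 ∷ [])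
      ∷ (6 ∷ 1 ∷ 5 ∷ 3 ∷ 7 ∷ 2 ∷ 8 ∷ 0 ∷ 4 ∷ [])
      ∷ (2 ∷ 3 ∷ 7 ∷ 8 ∷ 0 ∷ 4 ∷ 1 ∷ 5 ∷ 6 ∷ [])
      ∷ [])
  ∷ ( (0 ∷ 4 ∷ 8 ∷ 7 ∷ 2 ∷ 3 ∷ 5 ∷ 6 ∷ 1 ∷ [])
      ∷ (5 ∷ 6 ∷ 1 ∷ 0 ∷ 4 ∷ 8 ∷ 7 ∷ 2 ∷ 3 ∷ [])
      ∷ (7 ∷ 2 ∷ 3 ∷ 5 ∷ 6 ∷ 1 ∷ 0 ∷ 4 ∷ 8 ∷ [])
      ∷ (8 ∷ 0 ∷ 4 ∷ 6 ∷ 1 ∷ 5 ∷ 2 ∷ 3 ∷ 7 ∷ [])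
      ∷ (1 ∷ 5 ∷ 6 ∷ 2 ∷ 3 ∷ 7 ∷ 4 ∷ 8 ∷ 0 ∷ [])
      ∷ (3 ∷ 7 ∷ 2 ∷ 4 ∷ 8 ∷ 0 ∷ 6 ∷ 1 ∷ 5 ∷ [])
      ∷ (4 ∷ 8 ∷ 0 ∷ 3 ∷ 7 ∷ 2 ∷ 1 ∷ 5 ∷ 6 ∷ [])
      ∷ (6 ∷ 1 ∷ 5 ∷ 8 ∷ 0 ∷ 4 ∷ 3 ∷ 7 ∷ 2 ∷ [])
      ∷ (2 ∷ 3 ∷ 7 ∷ 1 ∷ 5 ∷ 6 ∷ 8 ∷ 0 ∷ 4 ∷ [])
      ∷ [])
  ∷ ( (0 ∷ 4 ∷ 8 ∷ 7 ∷ 2 ∷ 3 ∷ 5 ∷ 6 ∷ 1 ∷ [])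
      ∷ (5 ∷ 6 ∷ 1 ∷ 0 ∷ 4 ∷ 8 ∷ 7 ∷ 2 ∷ 3 ∷ [])
      ∷ (7 ∷ 2 ∷ 3 ∷ 5 ∷ 6 ∷ 1 ∷ 0 ∷ 4 ∷ 8 ∷ [])
      ∷ (8 ∷ 0 ∷ 4 ∷ 6 ∷ 1 ∷ 5 ∷ 3 ∷ 7 ∷ 2 ∷ [])
      ∷ (1 ∷ 5 ∷ 6 ∷ 2 ∷ 3 ∷ 7 ∷ 8 ∷ 0 ∷ 4 ∷ [])
      ∷ (3 ∷ 7 ∷ 2 ∷ 4 ∷ 8 ∷ 0 ∷ 1 ∷ 5 ∷ 6 ∷ [])
      ∷ (4 ∷ 8 ∷ 0 ∷ 1 ∷ 5 ∷ 6 ∷ 2 ∷ 3 ∷ 7 ∷ [])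
      ∷ (6 ∷ 1 ∷ 5 ∷ 3 ∷ 7 ∷ 2 ∷ 4 ∷ 8 ∷ 0 ∷ [])
      ∷ (2 ∷ 3 ∷ 7 ∷ 8 ∷ 0 ∷ 4 ∷ 6 ∷ 1 ∷ 5 ∷ [])
      ∷ [])
  ∷ ( (0 ∷ 4 ∷ 8 ∷ 7 ∷ 2 ∷ 3 ∷ 5 ∷ 6 ∷ 1 ∷ [])
      ∷ (5 ∷ 6 ∷ 1 ∷ 0 ∷ 4 ∷ 8 ∷ 7 ∷ 2 ∷ 3 ∷ [])
      ∷ (7 ∷ 2 ∷ 3 ∷ 5 ∷ 6 ∷ 1 ∷ 0 ∷ 4 ∷ 8 ∷ [])
      ∷ (8 ∷ 0 ∷ 4 ∷ 6 ∷ 1 ∷ 5 ∷ 3 ∷ 7 ∷ 2 ∷ [])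
      ∷ (1 ∷ 5 ∷ 6 ∷ 2 ∷ 3 ∷ 7 ∷ 8 ∷ 0 ∷ 4 ∷ [])
      ∷ (3 ∷ 7 ∷ 2 ∷ 4 ∷ 8 ∷ 0 ∷ 1 ∷ 5 ∷ 6 ∷ [])
      ∷ (4 ∷ 8 ∷ 0 ∷ 3 ∷ 7 ∷ 2 ∷ 6 ∷ 1 ∷ 5 ∷ [])
      ∷ (6 ∷ 1 ∷ 5 ∷ 8 ∷ 0 ∷ 4 ∷ 2 ∷ 3 ∷ 7 ∷ [])
      ∷ (2 ∷ 3 ∷ 7 ∷ 1 ∷ 5 ∷ 6 ∷ 4 ∷ 8 ∷ 0 ∷ [])
      ∷ [])
  ∷ []

catalogue : Fin 16 → Board
catalogue i r c = digit (lookup (lookup (lookup catalogueTable i) r) c)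

gnomonCells : List Cell
gnomonCells = firstBlockCells ++ otherFirstBandCells ++ otherFirstPillarCells

restrict : Board → List Cell → Assignment
restrict B = map λ x → x , At B x

standardBoard : Board
standardBoard = catalogue zero

firstBlockTarget firstBandTarget gnomonTarget : Assignment
firstBlockTarget = restrict standardBoard firstBlockCells
firstBandTarget  = restrict standardBoard (firstBlockCells ++ otherFirstBandCells)
gnomonTarget     = restrict standardBoard gnomonCells

catalogue-semiMagic : ∀ i → IsSemiMagicBoard (catalogue i)
catalogue-semiMagic = decide (all? λ i → semiMagic? (catalogue i)) refl

inGnomon? : ∀ r c → Dec (InGnomon r c)
inGnomon? r c = toℕ r ℕ.<? 3 ⊎-dec toℕ c ℕ.<? 3

standardBoard-gnomon : HasStandardGnomon standardBoard
standardBoard-gnomon = decide (all? λ r → all? λ c →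
  inGnomon? r c →-dec toℕ (standardBoard r c) ℕ.≟ lookup (lookup stdTable r) c) refl

∈-gnomonCells : ∀ r c → InGnomon r c → (r , c) ∈ gnomonCells
∈-gnomonCells = decide (all? λ r → all? λ c → inGnomon? r c →-dec (r , c) ∈? gnomonCells) refl
  where open import Data.List.Membership.DecPropositional (≡-dec _≟_ _≟_) using (_∈?_)

gnomonCells-InGnomon : All (uncurry InGnomon) gnomonCells
gnomonCells-InGnomon = decide (All.all? (uncurry inGnomon?) gnomonCells) refl

standardGnomon⇒gnomonTarget : ∀ {B} → HasStandardGnomon B → B ⊨ gnomonTarget
standardGnomon⇒gnomonTarget {B} standard = map⁺ (All.map agree gnomonCells-InGnomon)
  where
  agree : ∀ {x} → uncurry InGnomon x → At B x ≡ At standardBoard x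
  agree {r , c} g = toℕ-injective (trans (standard r c g) (sym (standardBoard-gnomon r c g)))

gnomonTarget⇒standardGnomon : ∀ {B} → B ⊨ gnomonTarget → HasStandardGnomon B
gnomonTarget⇒standardGnomon {B} h r c g =
  trans (cong toℕ (All.lookup agrees (∈-gnomonCells r c g))) (standardBoard-gnomon r c g)
  where
  agrees : All (λ x → At B x ≡ At standardBoard x) gnomonCells
  agrees = map⁻ h

-- 2×2 patterns [x y / z w] of corner entries; the k-th one weighs 4^k.
rectanglePatterns : List (ℕ × ℕ × ℕ × ℕ)
rectanglePatterns = (0 , 1 , 6 , 0) ∷ (6 , 8 , 0 , 6) ∷ (1 , 0 , 7 , 6) ∷ (6 , 8 , 0 , 3) ∷ (5 , 1 , 4 , 8) ∷ []

patternWeight : List (ℕ × ℕ × ℕ × ℕ) → Fin 9 → Fin 9 → Fin 9 → Fin 9 → ℕ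
patternWeight []                    x y z w = 0
patternWeight ((a , b , c , d) ∷ ps) x y z w =
  (if (toℕ x ≡ᵇ a) ∧ (toℕ y ≡ᵇ b) ∧ (toℕ z ≡ᵇ c) ∧ (toℕ w ≡ᵇ d) then 1 else 0) + 4 * patternWeight ps x y z w

open RectangleInvariant (patternWeight rectanglePatterns) public

catalogueInvariants : Vec ℕ 16
catalogueInvariants = 20 ∷ 8 ∷ 37 ∷ 10 ∷ 257 ∷ 336 ∷ 256 ∷ 320 ∷ 32 ∷ 5 ∷ 16 ∷ 4 ∷ 0 ∷ 64 ∷ 2 ∷ 81 ∷ []

invariant-catalogue : ∀ i → invariant (catalogue i) ≡ lookup catalogueInvariants i
invariant-catalogue = decide (all? λ i → invariant (catalogue i) ℕ.≟ lookup catalogueInvariants i) refl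

catalogueInvariants-injective : ∀ i j → lookup catalogueInvariants i ≡ lookup catalogueInvariants j → i ≡ j
catalogueInvariants-injective =
  decide (all? λ i → all? λ j → lookup catalogueInvariants i ℕ.≟ lookup catalogueInvariants j →-dec i ≟ j) refl

catalogue-[a,b]-injective : ∀ i j → r7c6 (catalogue i) ≡ r7c6 (catalogue j) → r6c7 (catalogue i) ≡ r6c7 (catalogue j) → i ≡ j
catalogue-[a,b]-injective = decide (all? λ i → all? λ j →
  r7c6 (catalogue i) ≟ r7c6 (catalogue j) →-dec r6c7 (catalogue i) ≟ r6c7 (catalogue j) →-dec i ≟ j) refl

firstBlock-search : search (reachableBy firstBlockWords firstBlockTarget) firstBlockCells [] ≡ true
firstBlock-search = refl

firstBand-search : search (reachableBy firstBandWords firstBandTarget) otherFirstBandCells firstBlockTarget ≡ true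
firstBand-search = refl

gnomon-search : search (reachableBy firstPillarWords gnomonTarget) otherFirstPillarCells firstBandTarget ≡ true
gnomon-search = refl

catalogue-search : search (inCatalogue catalogue) nonGnomonCells gnomonTarget ≡ true
catalogue-search = refl

-- Opaque: otherwise checking their uses unfolds the searches.
opaque
  normalise : (_⊨ []) ⇝ HasStandardGnomon
  normalise = ⇝-map gnomonTarget⇒standardGnomon (⇝-trans (⇝-trans toFirstBlock toFirstBand) toGnomon)
    where
    toFirstBlock : (_⊨ []) ⇝ (_⊨ firstBlockTarget)
    toFirstBlock = search-reachableBy firstBlockWords firstBlockTarget firstBlockCells [] firstBlock-search
    toFirstBand : (_⊨ firstBlockTarget) ⇝ (_⊨ firstBandTarget)
    toFirstBand = search-reachableBy firstBandWords firstBandTarget otherFirstBandCells firstBlockTarget firstBand-search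
    toGnomon : (_⊨ firstBandTarget) ⇝ (_⊨ gnomonTarget)
    toGnomon = search-reachableBy firstPillarWords gnomonTarget otherFirstPillarCells firstBandTarget gnomon-search

  classify : ∀ B → IsSemiMagicBoard B → HasStandardGnomon B → ∃ λ i → B ≈B catalogue i
  classify B sm standard =
    search-inCatalogue catalogue nonGnomonCells gnomonTarget catalogue-search B sm (standardGnomon⇒gnomonTarget standard)

catalogue-distinct : ∀ i j → i ≢ j → ¬ SameNest (catalogue i) (catalogue j)
catalogue-distinct i j i≢j nest = i≢j (catalogueInvariants-injective i j
  (trans (sym (invariant-catalogue i)) (trans (invariant-SameNest {catalogue i} {catalogue j} nest) (invariant-catalogue j))))

invariant-≈catalogue : ∀ {B i} → B ≈B catalogue i → invariant B ≡ lookup catalogueInvariants i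
invariant-≈catalogue {B} {i} B≈i = trans (invariant-cong {B} {catalogue i} B≈i) (invariant-catalogue i)

≈catalogue-injective : ∀ {B B' i j} → B ≈B catalogue i → B' ≈B catalogue j → i ≡ j → B ≈B B'
≈catalogue-injective B≈i B'≈j refl = ≈B-trans B≈i (≈B-sym B'≈j)

standard-invariant-injective : ∀ {B B'} → IsSemiMagicBoard B → HasStandardGnomon B →
  IsSemiMagicBoard B' → HasStandardGnomon B' → invariant B ≡ invariant B' → B ≈B B'
standard-invariant-injective {B} {B'} sm standard sm' standard' same =
  let i , B≈i  = classify B sm standard
      j , B'≈j = classify B' sm' standard'
  in ≈catalogue-injective B≈i B'≈j (catalogueInvariants-injective i j
       (trans (sym (invariant-≈catalogue {i = i} B≈i)) (trans same (invariant-≈catalogue {i = j} B'≈j))))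

standard-[a,b]-injective : ∀ B B' → IsSemiMagicBoard B → HasStandardGnomon B →
  IsSemiMagicBoard B' → HasStandardGnomon B' → r7c6 B ≡ r7c6 B' → r6c7 B ≡ r6c7 B' → B ≈B B'
standard-[a,b]-injective B B' sm standard sm' standard' same-a same-b =
  let i , B≈i  = classify B sm standard
      j , B'≈j = classify B' sm' standard'
  in ≈catalogue-injective B≈i B'≈j (catalogue-[a,b]-injective i j
       (trans (sym (B≈i _ _)) (trans same-a (B'≈j _ _)))
       (trans (sym (B≈i _ _)) (trans same-b (B'≈j _ _))))

catalogue-covers : ∀ B → IsSemiMagicBoard B → ∃ λ i → SameNest (catalogue i) B
catalogue-covers B sm =
  let w , standard = move normalise B sm []
      i , wB≈i     = classify (act w B) (act-semiMagic w B sm) standard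
  in i , SameNest-sym (w , wB≈i)

standard-representative : ∀ B → IsSemiMagicBoard B →
  ∃ λ B' → IsSemiMagicBoard B' × HasStandardGnomon B' × SameNest B B'
    × (∀ B'' → IsSemiMagicBoard B'' → HasStandardGnomon B'' → SameNest B B'' → B'' ≈B B')
standard-representative B sm =
  let w , standard = move normalise B sm []
  in act w B , act-semiMagic w B sm , standard , (w , λ _ _ → refl) , λ B'' sm'' standard'' nest'' →
       standard-invariant-injective sm'' standard'' (act-semiMagic w B sm) standard
         (trans (sym (invariant-SameNest nest'')) (sym (invariant-act w B)))

theorem3 :
    (∀ B → IsSemiMagicBoard B →
       ∃ λ w → IsSemiMagicBoard (act w B) × HasStandardGnomon (act w B))
    × (∃ λ (N : Fin 16 → Board) →
         (∀ i → IsSemiMagicBoard (N i))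
       × (∀ i j → i ≢ j → ¬ SameNest (N i) (N j))
       × (∀ B → IsSemiMagicBoard B → ∃ λ i → SameNest (N i) B))
    × (∀ B → IsSemiMagicBoard B →
         ∃ λ B' → IsSemiMagicBoard B' × HasStandardGnomon B' × SameNest B B'
           × (∀ B'' → IsSemiMagicBoard B'' → HasStandardGnomon B'' → SameNest B B'' → B'' ≈B B'))
    × (∀ B B' → IsSemiMagicBoard B → HasStandardGnomon B →
         IsSemiMagicBoard B' → HasStandardGnomon B' →
         r7c6 B ≡ r7c6 B' → r6c7 B ≡ r6c7 B' → B ≈B B')
theorem3 =
    (λ B sm → let w , standard = move normalise B sm [] in w , act-semiMagic w B sm , standard)
  , (catalogue , catalogue-semiMagic , catalogue-distinct , catalogue-covers)
  , standard-representative
  , standard-[a,b]-injective
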